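{- Let $k$ and $m$ be integers with $1<m<k$ and $m$ odd. Let $[\mathbf{u}]$ and $[\mathbf{w}]$ be distinct vertices of $\widetilde\Omega_{2k}$, both of weight $(m,2k-m)$. Then there exists a vertex $[\mathbf{y}]$ of $\widetilde\Omega_{2k}$ of weight $(k-1,k+1)$ that is adjacent to $[\mathbf{u}]$ but not to $[\mathbf{w}]$.
   Context: The orthogonality graph $\Omega_{2k}$ has vertex set $\mathbb{Z}_2^{2k}$ (bitstrings of length $2k$), with two vertices adjacent if and only if they differ in exactly $k$ positions. $\mathbf{1}$ is the all-ones bitstring, $+$ is bitwise addition mod 2, and $\mathrm{wt}(\mathbf{x})$ is the number of 1s in $\mathbf{x}$. The quotient graph $\widetilde\Omega_{2k}$ has vertices $[\mathbf{u}]=\{\mathbf{u},\mathbf{u}+\mathbf{1}\}$, with $[\mathbf{u}]$ adjacent to $[\mathbf{x}]$ iff some element of $[\mathbf{u}]$ is adjacent in $\Omega_{2k}$ to some element of $[\mathbf{x}]$. The weight of $[\mathbf{x}]$ is $(\mathrm{wt}(\mathbf{x}),2k-\mathrm{wt}(\mathbf{x}))$, with the representative chosen so that $\mathrm{wt}(\mathbf{x})\leq k$. -}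

module Defs where

open import Data.Nat using (ℕ; zero; suc; _+_; _≤_)
open import Data.Bool using (Bool; true; false; not; _xor_)
open import Data.Vec using (Vec; []; _∷_; zipWith)
open import Data.Product using (Σ; _×_; ∃-syntax)
open import Data.Sum using (_⊎_)
open import Relation.Binary.PropositionalEquality using (_≡_)
open import Relation.Nullary using (¬_)

Bits : ℕ → Set
Bits n = Vec Bool n

ones : (n : ℕ) → Bits n
ones zero = []
ones (suc n) = true ∷ ones n

_⊕_ : ∀ {n} → Bits n → Bits n → Bits n
_⊕_ = zipWith _xor_

wt : ∀ {n} → Bits n → ℕ
wt [] = 0
wt (true ∷ xs) = suc (wt xs)
wt (false ∷ xs) = wt xs

-- Orthogonality graph Ω_{2k}: vertex set Bits (k + k); adjacency iff
-- differ in exactly k positions, i.e. wt (x ⊕ y) ≡ k.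
Adj : (k : ℕ) → Bits (k + k) → Bits (k + k) → Set
Adj k x y = wt (x ⊕ y) ≡ k

InClass : (k : ℕ) → Bits (k + k) → Bits (k + k) → Set
InClass k x u = (x ≡ u) ⊎ (x ≡ u ⊕ ones (k + k))

SameClass : (k : ℕ) → Bits (k + k) → Bits (k + k) → Set
SameClass k u w = InClass k w u

QAdj : (k : ℕ) → Bits (k + k) → Bits (k + k) → Set
QAdj k u x = ∃[ a ] ∃[ b ] (InClass k a u × InClass k b x × Adj k a b)

-- [x] has weight (a, 2k - a): the representative of [x] with wt ≤ k has wt a.
HasWeight : (k : ℕ) → Bits (k + k) → ℕ → Set
HasWeight k x a = ∃[ r ] (InClass k r x × wt r ≤ k × wt r ≡ a)

-- Take representatives r ∈ [u] and s ∈ [w] of odd weight m = 2t+1 and write k = m+1+p.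
-- Since wt (x ⊕ y) + 2 ∣ x ∩ y ∣ = wt x + wt y, a vector y of weight k−1 with ∣ r ∩ y ∣ = t
-- has wt (r ⊕ y) = k, while ∣ s ∩ y ∣ = t+1 gives wt (s ⊕ y) = k−2, so neither s ⊕ y nor
-- its complement has weight k. Such a y exists because r ≠ s have equal weight, so r∖s and
-- s∖r are equinumerous and nonempty: if ∣ r∖s ∣ > t take t points of r∖s and t+1 of s∖r,
-- otherwise t points of r ∩ s and one of s∖r; then pad with points outside r ∪ s, of
-- which there are enough since m < k.
module Submission where

open import Defs
open import Data.Nat using (ℕ; suc; _+_; _<_; _∸_)
open import Data.Nat.DivMod using (_%_)
open import Relation.Binary.PropositionalEquality using (_≡_)
open import Data.Product using (_×_; ∃-syntax)
open import Relation.Nullary using (¬_)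

open import Data.Bool using (true; false)
open import Data.Bool.Properties using (xor-assoc; xor-comm)
open import Data.Nat using (zero; _*_; _≤_; z≤n; s≤s; _<?_)
open import Data.Nat.Properties
  using (+-suc; +-comm; +-identityʳ; *-comm; +-cancelˡ-≡; +-cancelʳ-≡; +-cancelʳ-≤; +-monoʳ-≤;
         m+n≡0⇒n≡0; m≢1+n+m; n≢0⇒n>0; ≤-trans; ≤-reflexive; <⇒≤; ≮⇒≥; m≤m+n; m≤n+m; n≤1+n;
         m≤n⇒∃[o]m+o≡n; module ≤-Reasoning)
open import Data.Nat.DivMod using (_/_; m≡m%n+[m/n]*n)
open import Data.Nat.Solver using (module +-*-Solver)
open import Data.Vec using ([]; _∷_)
open import Data.Vec.Properties using (zipWith-assoc; zipWith-comm)
open import Data.Product using (_,_)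
open import Data.Sum using (_⊎_; inj₁; inj₂)
open import Relation.Nullary using (yes; no)
open import Relation.Binary.PropositionalEquality
  using (_≢_; refl; sym; trans; cong; cong₂; subst; module ≡-Reasoning)

open +-*-Solver

complement : ∀ {n} → Bits n → Bits n
complement {n} x = x ⊕ ones n

complement-involutive : ∀ {n} (x : Bits n) → complement (complement x) ≡ x
complement-involutive [] = refl
complement-involutive (true ∷ x) = cong (true ∷_) (complement-involutive x)
complement-involutive (false ∷ x) = cong (false ∷_) (complement-involutive x)

⊕-complementʳ : ∀ {n} (x y : Bits n) → x ⊕ complement y ≡ complement (x ⊕ y)
⊕-complementʳ {n} x y = sym (zipWith-assoc xor-assoc x y (ones n))

⊕-complementˡ : ∀ {n} (x y : Bits n) → complement x ⊕ y ≡ complement (x ⊕ y)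
⊕-complementˡ {n} x y = begin
  (x ⊕ ones n) ⊕ y    ≡⟨ zipWith-assoc xor-assoc x (ones n) y ⟩
  x ⊕ (ones n ⊕ y)    ≡⟨ cong (x ⊕_) (zipWith-comm xor-comm (ones n) y) ⟩
  x ⊕ complement y    ≡⟨ ⊕-complementʳ x y ⟩
  complement (x ⊕ y)  ∎
  where open ≡-Reasoning

⊕-complement-complement : ∀ {n} (x y : Bits n) → complement x ⊕ complement y ≡ x ⊕ y
⊕-complement-complement x y = begin
  complement x ⊕ complement y       ≡⟨ ⊕-complementˡ x (complement y) ⟩
  complement (x ⊕ complement y)     ≡⟨ cong complement (⊕-complementʳ x y) ⟩
  complement (complement (x ⊕ y))   ≡⟨ complement-involutive (x ⊕ y) ⟩
  x ⊕ y                             ∎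
  where open ≡-Reasoning

wt-complement : ∀ {n} (x : Bits n) → wt (complement x) + wt x ≡ n
wt-complement [] = refl
wt-complement {suc n} (true ∷ x) = trans (+-suc _ _) (cong suc (wt-complement x))
wt-complement (false ∷ x) = cong suc (wt-complement x)

-- x ∈[ u ] is InClass without the restriction to length k + k.
_∈[_] : ∀ {n} → Bits n → Bits n → Set
x ∈[ u ] = x ≡ u ⊎ x ≡ complement u

∈[]-sym : ∀ {n} {x u : Bits n} → x ∈[ u ] → u ∈[ x ]
∈[]-sym (inj₁ refl) = inj₁ refl
∈[]-sym {u = u} (inj₂ refl) = inj₂ (sym (complement-involutive u))

∈[]-trans : ∀ {n} {x y z : Bits n} → x ∈[ y ] → y ∈[ z ] → x ∈[ z ]
∈[]-trans (inj₁ refl) y∈[z] = y∈[z]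
∈[]-trans (inj₂ refl) (inj₁ refl) = inj₂ refl
∈[]-trans {z = z} (inj₂ refl) (inj₂ refl) = inj₁ (complement-involutive z)

∈[]-⊕ : ∀ {n} {a b x y : Bits n} → a ∈[ x ] → b ∈[ y ] → (a ⊕ b) ∈[ x ⊕ y ]
∈[]-⊕ (inj₁ refl) (inj₁ refl) = inj₁ refl
∈[]-⊕ {x = x} {y} (inj₁ refl) (inj₂ refl) = inj₂ (⊕-complementʳ x y)
∈[]-⊕ {x = x} {y} (inj₂ refl) (inj₁ refl) = inj₂ (⊕-complementˡ x y)
∈[]-⊕ {x = x} {y} (inj₂ refl) (inj₂ refl) = inj₁ (⊕-complement-complement x y)

wt-∈[] : ∀ {n} {x u : Bits n} → x ∈[ u ] → wt x ≡ wt u ⊎ wt x + wt u ≡ n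
wt-∈[] (inj₁ refl) = inj₁ refl
wt-∈[] {u = u} (inj₂ refl) = inj₂ (wt-complement u)

∣_∩_∣ : ∀ {n} → Bits n → Bits n → ℕ
∣ [] ∩ [] ∣ = 0
∣ true ∷ x ∩ true ∷ y ∣ = suc ∣ x ∩ y ∣
∣ _ ∷ x ∩ _ ∷ y ∣ = ∣ x ∩ y ∣

wt-⊕+∩ : ∀ {n} (x y : Bits n) →
  wt (x ⊕ y) + (∣ x ∩ y ∣ + ∣ x ∩ y ∣) ≡ wt x + wt y
wt-⊕+∩ [] [] = refl
wt-⊕+∩ (true ∷ x) (true ∷ y) = begin
  wt (x ⊕ y) + (suc o + suc o)      ≡⟨ +-suc (wt (x ⊕ y)) (o + suc o) ⟩
  suc (wt (x ⊕ y) + (o + suc o))    ≡⟨ cong (λ q → suc (wt (x ⊕ y) + q)) (+-suc o o) ⟩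
  suc (wt (x ⊕ y) + suc (o + o))    ≡⟨ cong suc (+-suc (wt (x ⊕ y)) (o + o)) ⟩
  suc (suc (wt (x ⊕ y) + (o + o)))  ≡⟨ cong (λ q → suc (suc q)) (wt-⊕+∩ x y) ⟩
  suc (suc (wt x + wt y))           ≡⟨ cong suc (+-suc (wt x) (wt y)) ⟨
  suc (wt x + suc (wt y))           ∎
  where open ≡-Reasoning
        o = ∣ x ∩ y ∣
wt-⊕+∩ (true ∷ x) (false ∷ y) = cong suc (wt-⊕+∩ x y)
wt-⊕+∩ (false ∷ x) (true ∷ y) =
  trans (cong suc (wt-⊕+∩ x y)) (sym (+-suc (wt x) (wt y)))
wt-⊕+∩ (false ∷ x) (false ∷ y) = wt-⊕+∩ x y

wt-⊕-by-∩ : ∀ {n} (x y : Bits n) {o j} → ∣ x ∩ y ∣ ≡ o →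
  wt x + wt y ≡ j + (o + o) → wt (x ⊕ y) ≡ j
wt-⊕-by-∩ x y {o} {j} refl e = +-cancelʳ-≡ (o + o) (wt (x ⊕ y)) j (trans (wt-⊕+∩ x y) e)

wt-splitˡ : ∀ {n} (x y : Bits n) → wt x ≡ ∣ x ∩ y ∣ + ∣ x ∩ complement y ∣
wt-splitˡ [] [] = refl
wt-splitˡ (true ∷ x) (true ∷ y) = cong suc (wt-splitˡ x y)
wt-splitˡ (true ∷ x) (false ∷ y) = trans (cong suc (wt-splitˡ x y)) (sym (+-suc _ _))
wt-splitˡ (false ∷ x) (_ ∷ y) = wt-splitˡ x y

wt-splitʳ : ∀ {n} (x y : Bits n) → wt y ≡ ∣ x ∩ y ∣ + ∣ complement x ∩ y ∣
wt-splitʳ [] [] = refl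
wt-splitʳ (true ∷ x) (true ∷ y) = cong suc (wt-splitʳ x y)
wt-splitʳ (false ∷ x) (true ∷ y) = trans (cong suc (wt-splitʳ x y)) (sym (+-suc _ _))
wt-splitʳ (true ∷ x) (false ∷ y) = wt-splitʳ x y
wt-splitʳ (false ∷ x) (false ∷ y) = wt-splitʳ x y

∩-cells : ∀ {n} (x y : Bits n) →
  ∣ x ∩ y ∣ + ∣ x ∩ complement y ∣
    + (∣ complement x ∩ y ∣ + ∣ complement x ∩ complement y ∣) ≡ n
∩-cells x y = begin
  _                         ≡⟨ cong₂ _+_ (wt-splitˡ x y) (wt-splitˡ (complement x) y) ⟨
  wt x + wt (complement x)  ≡⟨ +-comm (wt x) _ ⟩
  wt (complement x) + wt x  ≡⟨ wt-complement x ⟩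
  _                         ∎
  where open ≡-Reasoning

∩-complements≡0⇒≡ : ∀ {n} (x y : Bits n) →
  ∣ x ∩ complement y ∣ + ∣ complement x ∩ y ∣ ≡ 0 → x ≡ y
∩-complements≡0⇒≡ [] [] _ = refl
∩-complements≡0⇒≡ (true ∷ x) (true ∷ y) e = cong (true ∷_) (∩-complements≡0⇒≡ x y e)
∩-complements≡0⇒≡ (false ∷ x) (false ∷ y) e = cong (false ∷_) (∩-complements≡0⇒≡ x y e)
∩-complements≡0⇒≡ (true ∷ x) (false ∷ y) ()
∩-complements≡0⇒≡ (false ∷ x) (true ∷ y) e with m+n≡0⇒n≡0 ∣ x ∩ complement y ∣ e
... | ()

select-from-cells : ∀ {n} (x y : Bits n) {a b c d : ℕ} →
  a ≤ ∣ x ∩ y ∣ → b ≤ ∣ x ∩ complement y ∣ →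
  c ≤ ∣ complement x ∩ y ∣ → d ≤ ∣ complement x ∩ complement y ∣ →
  ∃[ z ] (wt z ≡ a + b + c + d × ∣ x ∩ z ∣ ≡ a + b × ∣ y ∩ z ∣ ≡ a + c)
select-from-cells [] [] z≤n z≤n z≤n z≤n = [] , refl , refl , refl
select-from-cells (true ∷ x) (true ∷ y) {zero} z≤n pb pc pd
  with select-from-cells x y z≤n pb pc pd
... | z , wz , xz , yz = false ∷ z , wz , xz , yz
select-from-cells (true ∷ x) (true ∷ y) {suc a} (s≤s pa) pb pc pd
  with select-from-cells x y pa pb pc pd
... | z , wz , xz , yz = true ∷ z , cong suc wz , cong suc xz , cong suc yz
select-from-cells (true ∷ x) (false ∷ y) {b = zero} pa z≤n pc pd
  with select-from-cells x y pa z≤n pc pd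
... | z , wz , xz , yz = false ∷ z , wz , xz , yz
select-from-cells (true ∷ x) (false ∷ y) {a} {suc b} {c} {d} pa (s≤s pb) pc pd
  with select-from-cells x y pa pb pc pd
... | z , wz , xz , yz = true ∷ z ,
  trans (cong suc wz) (cong (λ q → q + c + d) (sym (+-suc a b))) ,
  trans (cong suc xz) (sym (+-suc a b)) , yz
select-from-cells (false ∷ x) (true ∷ y) {c = zero} pa pb z≤n pd
  with select-from-cells x y pa pb z≤n pd
... | z , wz , xz , yz = false ∷ z , wz , xz , yz
select-from-cells (false ∷ x) (true ∷ y) {a} {b} {suc c} {d} pa pb (s≤s pc) pd
  with select-from-cells x y pa pb pc pd
... | z , wz , xz , yz = true ∷ z ,
  trans (cong suc wz) (cong (_+ d) (sym (+-suc (a + b) c))) ,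
  xz , trans (cong suc yz) (sym (+-suc a c))
select-from-cells (false ∷ x) (false ∷ y) {d = zero} pa pb pc z≤n
  with select-from-cells x y pa pb pc z≤n
... | z , wz , xz , yz = false ∷ z , wz , xz , yz
select-from-cells (false ∷ x) (false ∷ y) {a} {b} {c} {suc d} pa pb pc (s≤s pd)
  with select-from-cells x y pa pb pc pd
... | z , wz , xz , yz = true ∷ z , trans (cong suc wz) (sym (+-suc (a + b + c) d)) , xz , yz

x+y≡u+v∧y≤u⇒v≤x : ∀ {x y u v} → x + y ≡ u + v → y ≤ u → v ≤ x
x+y≡u+v∧y≤u⇒v≤x {x} {y} {u} {v} e y≤u = +-cancelʳ-≤ y v x (begin
  v + y  ≤⟨ +-monoʳ-≤ v y≤u ⟩
  v + u  ≡⟨ +-comm v u ⟩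
  u + v  ≡⟨ e ⟨
  x + y  ∎)
  where open ≤-Reasoning

-- A, B and D play the roles of ∣ r ∩ s ∣, ∣ r∖s ∣ = ∣ s∖r ∣ and the number of points outside
-- r ∪ s, for r and s of weight 2t+1 in a ground set of size 2(2t+2+p).
venn-choice : ∀ t p {A B D} → A + B ≡ suc (t + t) →
  D + B ≡ suc (t + t) + suc (suc (p + p)) → 1 ≤ B →
  ∃[ a ] ∃[ b ] ∃[ c ] ∃[ d ] (a ≤ A × b ≤ B × c ≤ B × d ≤ D ×
    a + b + c + d ≡ suc (t + t) + p × a + b ≡ t × a + c ≡ suc t)
venn-choice t p {A} {B} {D} A+B D+B 1≤B with t <? B
... | yes t<B = 0 , t , suc t , p , z≤n , <⇒≤ t<B , t<B , p≤D ,
  cong (_+ p) (+-suc t t) , refl , refl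
  where
  B≤m : B ≤ suc (t + t)
  B≤m = subst (B ≤_) A+B (m≤n+m B A)
  p≤D : p ≤ D
  p≤D = ≤-trans (≤-trans (m≤m+n p p) (m≤n+m (p + p) 2)) (x+y≡u+v∧y≤u⇒v≤x D+B B≤m)
... | no t≮B = t , 0 , 1 , t + p , t≤A , z≤n , 1≤B , t+p≤D ,
  solve 2 (λ t p → t :+ con 0 :+ con 1 :+ (t :+ p) := con 1 :+ (t :+ t) :+ p) refl t p ,
  +-identityʳ t , +-comm t 1
  where
  B≤t : B ≤ t
  B≤t = ≮⇒≥ t≮B
  t≤A : t ≤ A
  t≤A = <⇒≤ (x+y≡u+v∧y≤u⇒v≤x (trans A+B (sym (+-suc t t))) B≤t)
  D+B′ : D + B ≡ t + (t + p + suc (suc (suc p)))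
  D+B′ = trans D+B (solve 2 (λ t p → con 1 :+ (t :+ t) :+ (con 2 :+ (p :+ p))
                                   := t :+ (t :+ p :+ (con 3 :+ p))) refl t p)
  t+p≤D : t + p ≤ D
  t+p≤D = ≤-trans (m≤m+n (t + p) _) (x+y≡u+v∧y≤u⇒v≤x D+B′ B≤t)

cell-sizes : ∀ {k} t p → suc (suc (t + t)) + p ≡ k → (r s : Bits (k + k)) →
  wt r ≡ suc (t + t) → wt s ≡ suc (t + t) → r ≢ s →
  ∣ r ∩ s ∣ + ∣ r ∩ complement s ∣ ≡ suc (t + t) ×
  ∣ complement r ∩ complement s ∣ + ∣ r ∩ complement s ∣ ≡ suc (t + t) + suc (suc (p + p)) ×
  ∣ r ∩ complement s ∣ ≡ ∣ complement r ∩ s ∣ × ∣ r ∩ complement s ∣ ≢ 0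
cell-sizes t p refl r s wt-r wt-s r≢s = A+B , D+B , B≡C , B≢0
  where
  m = suc (t + t)
  A = ∣ r ∩ s ∣
  B = ∣ r ∩ complement s ∣
  C = ∣ complement r ∩ s ∣
  D = ∣ complement r ∩ complement s ∣
  A+B : A + B ≡ m
  A+B = trans (sym (wt-splitˡ r s)) wt-r
  B≡C : B ≡ C
  B≡C = +-cancelˡ-≡ A B C (trans A+B (trans (sym wt-s) (wt-splitʳ r s)))
  D+B : D + B ≡ m + suc (suc (p + p))
  D+B = +-cancelˡ-≡ m _ _ (begin
    m + (D + B)          ≡⟨ cong₂ (λ x y → x + (D + y)) A+B (sym B≡C) ⟨
    A + B + (D + C)      ≡⟨ cong (A + B +_) (+-comm D C) ⟩
    A + B + (C + D)      ≡⟨ ∩-cells r s ⟩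
    suc m + p + (suc m + p)
      ≡⟨ solve 2 (λ m p → con 1 :+ m :+ p :+ (con 1 :+ m :+ p)
                         := m :+ (m :+ (con 2 :+ (p :+ p)))) refl m p ⟩
    m + (m + suc (suc (p + p)))  ∎)
    where open ≡-Reasoning
  B≢0 : B ≢ 0
  B≢0 B≡0 = r≢s (∩-complements≡0⇒≡ r s (cong₂ _+_ B≡0 (trans (sym B≡C) B≡0)))

separating-vector : ∀ {k} t p → suc (suc (t + t)) + p ≡ k → (r s : Bits (k + k)) →
  wt r ≡ suc (t + t) → wt s ≡ suc (t + t) → r ≢ s →
  ∃[ y ] (wt y ≡ suc (t + t) + p × ∣ r ∩ y ∣ ≡ t × ∣ s ∩ y ∣ ≡ suc t)
separating-vector t p k≡ r s wt-r wt-s r≢s with cell-sizes t p k≡ r s wt-r wt-s r≢s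
... | A+B , D+B , B≡C , B≢0 with venn-choice t p A+B D+B (n≢0⇒n>0 B≢0)
... | a , b , c , d , a≤A , b≤B , c≤B , d≤D , sum , a+b , a+c
  with select-from-cells r s a≤A b≤B (subst (c ≤_) B≡C c≤B) d≤D
... | y , wt-y , r∩y , s∩y = y , trans wt-y sum , trans r∩y a+b , trans s∩y a+c

representatives-distinct : ∀ {n} {r s u w : Bits n} →
  r ∈[ u ] → s ∈[ w ] → ¬ w ∈[ u ] → r ≢ s
representatives-distinct r∈[u] s∈[w] w∉[u] refl = w∉[u] (∈[]-trans (∈[]-sym s∈[w]) r∈[u])

not-adjacent : ∀ {k} {s w y : Bits (k + k)} → s ∈[ w ] →
  suc (suc (wt (s ⊕ y))) ≡ k → ¬ QAdj k w y
not-adjacent {k} {s} {w} {y} s∈[w] k≡ (a , b , a∈[w] , b∈[y] , adj)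
  with wt-∈[] (∈[]-⊕ (∈[]-trans a∈[w] (∈[]-sym s∈[w])) b∈[y])
... | inj₁ same = m≢1+n+m (wt (s ⊕ y)) (trans (sym same) (trans adj (sym k≡)))
... | inj₂ complementary = m≢1+n+m (wt (s ⊕ y))
  (trans (+-cancelˡ-≡ k _ _ (trans (cong (_+ wt (s ⊕ y)) (sym adj)) complementary)) (sym k≡))

%2≡1⇒∃[t]≡1+t+t : ∀ m → m % 2 ≡ 1 → ∃[ t ] m ≡ suc (t + t)
%2≡1⇒∃[t]≡1+t+t m m%2≡1 = t , (begin
  m                  ≡⟨ m≡m%n+[m/n]*n m 2 ⟩
  m % 2 + t * 2      ≡⟨ cong (_+ t * 2) m%2≡1 ⟩
  suc (t * 2)        ≡⟨ cong suc (trans (*-comm t 2) (cong (t +_) (+-identityʳ t))) ⟩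
  suc (t + t)        ∎)
  where open ≡-Reasoning
        t = m / 2

corollary3 : (k m : ℕ) → 1 < m → m < k → m % 2 ≡ 1 →
    (u w : Bits (k + k)) → ¬ SameClass k u w →
    HasWeight k u m → HasWeight k w m →
    ∃[ y ] (HasWeight k y (k ∸ 1) × QAdj k u y × ¬ QAdj k w y)
corollary3 k m _ m<k m%2≡1 u w [u]≢[w] (r , r∈[u] , _ , wt-r) (s , s∈[w] , _ , wt-s)
  with %2≡1⇒∃[t]≡1+t+t m m%2≡1 | m≤n⇒∃[o]m+o≡n m<k
... | t , refl | p , refl
  with separating-vector t p refl r s wt-r wt-s (representatives-distinct r∈[u] s∈[w] [u]≢[w])
... | y , wt-y , r∩y , s∩y =
  y , (y , inj₁ refl , ≤-trans (≤-reflexive wt-y) (n≤1+n _) , wt-y) ,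
  (r , y , r∈[u] , inj₁ refl , r⊕y) , not-adjacent s∈[w] (cong (λ q → suc (suc q)) s⊕y)
  where
  r⊕y : wt (r ⊕ y) ≡ suc (suc (t + t)) + p
  r⊕y = wt-⊕-by-∩ r y r∩y (trans (cong₂ _+_ wt-r wt-y)
    (solve 2 (λ t p → con 1 :+ (t :+ t) :+ (con 1 :+ (t :+ t) :+ p)
                    := con 2 :+ (t :+ t) :+ p :+ (t :+ t)) refl t p))
  s⊕y : wt (s ⊕ y) ≡ t + t + p
  s⊕y = wt-⊕-by-∩ s y s∩y (trans (cong₂ _+_ wt-s wt-y)
    (solve 2 (λ t p → con 1 :+ (t :+ t) :+ (con 1 :+ (t :+ t) :+ p)
                    := t :+ t :+ p :+ ((con 1 :+ t) :+ (con 1 :+ t))) refl t p))
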